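{- Let $(E,\mathcal F,\mathcal L)$ be an oriented interval greedoid and $X\in\mathcal F$. Then $\mathcal L/X=\{\mathrm{con}_X(\alpha):\alpha\in\mathcal L,\ \mathrm{supp}(\alpha)\le[X]\}$ defines an oriented interval greedoid $(E_X,\mathcal F/X,\mathcal L/X)$ over the contraction of $(E,\mathcal F)$ by $X$.
   Context: Interval greedoid: finite $E$, nonempty family $\mathcal F$ with (IG1) each nonempty $X\in\mathcal F$ has $x$ with $X\setminus\{x\}\in\mathcal F$; (IG2) if $|X|>|Y|$ there is $x\in X\setminus Y$ with $Y\cup\{x\}\in\mathcal F$; (IG3) if $X\subseteq Y\subseteq Z$ in $\mathcal F$, $e\notin Z$, $X\cup\{e\},Z\cup\{e\}\in\mathcal F$, then $Y\cup\{e\}\in\mathcal F$. $\Gamma(X)=\{x\in E\setminus X:X\cup\{x\}\in\mathcal F\}$; $X\sim Y$ iff $\Gamma(X)=\Gamma(Y)$; classes $[X]$ are flats; $\Phi$ the set of flats ordered by $[X]\le[Y]$ iff there is $Z\subseteq E\setminus Y$ with $Y\cup Z\in\mathcal F$ and $Y\cup Z\sim X$ (a lattice). For a flat $A=[X]$: $\Gamma(A)=\Gamma(X)$, $\xi(A)=\bigcup_{X'\sim X}X'$; $\mu(S)=[X]$ for $X$ inclusion-maximal feasible in $S$; join $A\vee B=\mu(\xi(A)\cap\xi(B))$. A covector is $\alpha:E\to\{0,+,-,1\}$ such that for some flat $A=\mathrm{supp}(\alpha)$, $\alpha\in\{+,-\}$ on $\Gamma(A)$, $0$ on $\xi(A)$,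 $1$ elsewhere. Symbols ordered $0<+<1$, $0<-<1$. Product: with $C=\mathrm{supp}\,\alpha\vee\mathrm{supp}\,\beta$, $(\alpha\circ\beta)(e)=\beta(e)$ if $e\in\Gamma(C)\cup\xi(C)$ and $\beta(e)>\alpha(e)$; $\alpha(e)$ if $e\in\Gamma(C)\cup\xi(C)$ otherwise; $1$ otherwise. $-\alpha$ swaps $+,-$; $S(\alpha,\beta)=\{e:\alpha(e)=-\beta(e)\in\{+,-\}\}$. Oriented interval greedoid: $(E,\mathcal F,\mathcal L)$, $\mathcal L$ a set of covectors with (OG1) $\mathrm{supp}:\mathcal L\to\Phi$ surjective; (OG2) $-\mathcal L=\mathcal L$; (OG3) closed under $\circ$; (OG4) if $\alpha,\beta\in\mathcal L$, $x\in S(\alpha,\beta)$, $(\alpha\circ\beta)(x)\ne1$, some $\gamma\in\mathcal L$ has $\gamma(x)=0$ and $\gamma(y)=(\alpha\circ\beta)(y)=(\beta\circ\alpha)(y)$ for all $y\notin S(\alpha,\beta)$ with $(\alpha\circ\beta)(y)\neq1$. Contraction: for $X\in\mathcal F$, $\mathcal F/X=\{Y\subseteq E\setminus X: X\cup Y\in\mathcal F\}$ and $E_X=\bigcup_{Y\in\mathcal F/X}Y$; $(E_X,\mathcal F/X)$ is an interval greedoid, with its own continuations $\Gamma/X$, flats $\Phi/X$, etc. (one has $(\Gamma/X)(Y)=\Gamma(X\cup Y)$). For a covector $\alpha$ of $(E,\mathcal F)$ with $\mathrm{supp}(\alpha)\le[X]$ there is $Y\in\mathcal F/X$ with $\mathrm{supp}(\alpha)=[X\cup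 Y]$; $\mathrm{con}_X(\alpha):E_X\to\{0,+,-,1\}$ is the covector of $(E_X,\mathcal F/X)$ whose support is the flat of $Y$ in $\Phi/X$ and which agrees with $\alpha$ on $(\Gamma/X)(Y)$. -}

module Defs where

open import Data.Nat using (ℕ; _<_)
open import Data.Bool using (Bool; true; false; T)
open import Data.Empty using (⊥)
open import Data.Product using (Σ; ∃; _×_; _,_)
open import Data.Sum using (_⊎_)
open import Data.Fin using (Fin)
open import Data.Vec using (Vec; []; _∷_; lookup; map)
open import Data.Fin.Subset using (Subset; _∈_; _∉_; _⊆_; _∪_; _-_; ⁅_⁆; ∣_∣; Nonempty)
open import Relation.Nullary using (¬_)
open import Relation.Binary.PropositionalEquality using (_≡_; _≢_)

data Sign : Set where
  zer pos neg one : Sign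

data _<ˢ_ : Sign → Sign → Set where
  0<+ : zer <ˢ pos
  0<- : zer <ˢ neg
  0<1 : zer <ˢ one
  +<1 : pos <ˢ one
  -<1 : neg <ˢ one

negˢ : Sign → Sign
negˢ zer = zer
negˢ pos = neg
negˢ neg = pos
negˢ one = one

SignVec : ℕ → Set
SignVec n = Vec Sign n

_⇔_ : Set → Set → Set
A ⇔ B = (A → B) × (B → A)

-- Everything relative to a ground set E ⊆ Fin n (a predicate) and a
-- (finite, hence decidable) family F of subsets of Fin n.

module Greedoid {n : ℕ} (E : Fin n → Set) (F : Subset n → Bool) where

  Feas : Subset n → Set
  Feas X = T (F X)

  record IsIntervalGreedoid : Set where
    field
      ground   : ∀ X → Feas X → ∀ x → x ∈ X → E x
      nonempty : ∃ λ X → Feas X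
      IG1 : ∀ X → Feas X → Nonempty X → ∃ λ x → x ∈ X × Feas (X - x)
      IG2 : ∀ X Y → Feas X → Feas Y → ∣ Y ∣ < ∣ X ∣ →
            ∃ λ x → x ∈ X × x ∉ Y × Feas (Y ∪ ⁅ x ⁆)
      IG3 : ∀ X Y Z e → Feas X → Feas Y → Feas Z → X ⊆ Y → Y ⊆ Z → e ∉ Z →
            Feas (X ∪ ⁅ e ⁆) → Feas (Z ∪ ⁅ e ⁆) → Feas (Y ∪ ⁅ e ⁆)

  InΓ : Subset n → Fin n → Set
  InΓ X e = E e × e ∉ X × Feas (X ∪ ⁅ e ⁆)

  _∼_ : Subset n → Subset n → Set
  X ∼ Y = ∀ e → InΓ X e ⇔ InΓ Y e

  Inξ : Subset n → Fin n → Set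
  Inξ X e = ∃ λ X' → Feas X' × X' ∼ X × e ∈ X'

  -- [X] ≤ [Y] in the lattice of flats
  FlatLe : Subset n → Subset n → Set
  FlatLe X Y = ∃ λ Z → (∀ z → z ∈ Z → E z × z ∉ Y) × Feas (Y ∪ Z) × (Y ∪ Z) ∼ X

  -- α is a covector with supp(α) = [X]  (α is 1 outside Γ(X) ∪ ξ(X),
  -- in particular outside E)
  CovOf : Subset n → SignVec n → Set
  CovOf X α = Feas X ×
    (∀ e → (InΓ X e → (lookup α e ≡ pos ⊎ lookup α e ≡ neg))
         × (Inξ X e → lookup α e ≡ zer)
         × (¬ InΓ X e → ¬ Inξ X e → lookup α e ≡ one))

  IsCovector : SignVec n → Set
  IsCovector α = ∃ λ X → CovOf X α

  IsMaxFeasIn : (Fin n → Set) → Subset n → Set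
  IsMaxFeasIn S X = Feas X × (∀ e → e ∈ X → S e) ×
    (∀ Y → Feas Y → X ⊆ Y → (∀ e → e ∈ Y → S e) → Y ⊆ X)

  -- [Xc] = [Xa] ∨ [Xb] = μ(ξ[Xa] ∩ ξ[Xb])
  IsJoin : Subset n → Subset n → Subset n → Set
  IsJoin Xa Xb Xc = IsMaxFeasIn (λ e → Inξ Xa e × Inξ Xb e) Xc

  IsProd : SignVec n → SignVec n → SignVec n → Set
  IsProd α β γ = ∃ λ Xa → ∃ λ Xb → ∃ λ Xc →
    CovOf Xa α × CovOf Xb β × IsJoin Xa Xb Xc ×
    (∀ e → ((InΓ Xc e ⊎ Inξ Xc e) →
              (lookup α e <ˢ lookup β e → lookup γ e ≡ lookup β e)
            × (¬ (lookup α e <ˢ lookup β e) → lookup γ e ≡ lookup α e))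
         × (¬ (InΓ Xc e ⊎ Inξ Xc e) → lookup γ e ≡ one))

  InS : SignVec n → SignVec n → Fin n → Set
  InS α β e = (lookup α e ≡ pos × lookup β e ≡ neg)
            ⊎ (lookup α e ≡ neg × lookup β e ≡ pos)

  record IsOrientedIntervalGreedoid (L : SignVec n → Set) : Set where
    field
      isIG : IsIntervalGreedoid
      covectors : ∀ α → L α → IsCovector α
      OG1 : ∀ X → Feas X → ∃ λ α → L α × CovOf X α
      OG2 : ∀ α → L α → L (map negˢ α)
      OG3 : ∀ α β γ → L α → L β → IsProd α β γ → L γ
      OG4 : ∀ α β αβ βα x → L α → L β → IsProd α β αβ → IsProd β α βα →
            InS α β x → lookup αβ x ≢ one →
            ∃ λ γ → L γ × lookup γ x ≡ zer ×
              (∀ y → ¬ InS α β y → lookup αβ y ≢ one →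
                 lookup γ y ≡ lookup αβ y × lookup γ y ≡ lookup βα y)

disjoint? : ∀ {n} → Subset n → Subset n → Bool
disjoint? [] [] = true
disjoint? (true ∷ xs) (true ∷ ys) = false
disjoint? (_ ∷ xs) (_ ∷ ys) = disjoint? xs ys

conF : ∀ {n} → (F : Subset n → Bool) → Subset n → (Subset n → Bool)
conF F X Y with disjoint? X Y
... | true  = F (X ∪ Y)
... | false = false

conE : ∀ {n} → (F : Subset n → Bool) → Subset n → (Fin n → Set)
conE F X e = ∃ λ Y → T (conF F X Y) × e ∈ Y

-- L/X = { con_X(α) : α ∈ L, supp α ≤ [X] }.  γ = con_X(α) means: for Y ∈ F/X
-- with supp α = [X ∪ Y], γ is the covector of (E_X, F/X) with support the
-- flat of Y in Φ/X that agrees with α on (Γ/X)(Y).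
conL : ∀ {n} → (E : Fin n → Set) → (F : Subset n → Bool) →
       (SignVec n → Set) → Subset n → (SignVec n → Set)
conL E F L X γ = ∃ λ α → L α ×
  (∃ λ Xα → G.CovOf Xα α × G.FlatLe Xα X) ×
  (∃ λ Y → T (conF F X Y) × G.CovOf (X ∪ Y) α ×
     G/X.CovOf Y γ × (∀ e → G/X.InΓ Y e → lookup γ e ≡ lookup α e))
  where
    module G = Greedoid E F
    module G/X = Greedoid (conE F X) (conF F X)

-- Y ↦ X ∪ Y identifies F/X with the feasible sets containing X, and under it continuations,
-- the relation ∼ and the flats of F/X are those of F lying above [X]; a member of such a flat
-- containing X can always be cut back to the form X ∪ Y.  The greedoid axioms for F/X are
-- inherited from F (for accessibility, grow X inside X ∪ Y to one element short of it).
-- The contraction con_X commutes with negation, and con_X α ∘ con_X β = con_X (α ∘ β): the join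
-- over X lifts to the join of X ∪ Y₁ and X ∪ Y₂, which is supp (α ∘ β).  For elimination,
-- apply OG4 in L to α ∘ β and β ∘ α; the eliminant ε agrees with α ∘ β wherever the latter
-- vanishes, in particular on X, so supp ε ≤ [X] and con_X ε eliminates x over X.

module Submission where

open import Data.Bool using (Bool; true; false; T; T?)
open import Data.Empty using (⊥-elim)
open import Data.Fin using (Fin; zero; suc)
open import Data.Fin.Properties using (all?; any?)
open import Data.Fin.Subset using (Subset; _∈_; _∉_; _⊆_; _⊂_; _∪_; _─_; _-_; ⁅_⁆; ∣_∣; Nonempty; ⊥)
open import Data.Fin.Subset.Properties
  using (_∈?_; anySubset?; ⊆-antisym; p⊆q⇒∣p∣≤∣q∣; p⊂q⇒∣p∣<∣q∣; x∈p∪q⁺; x∈p∪q⁻; x∈⁅x⁆; x∈⁅y⁆⇒x≡y;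
         ∣⁅x⁆∣≡1; ∪-assoc; ∪-identityʳ; ∉⊥; x∈p∧x∉q⇒x∈p─q; x∈p∧x≢y⇒x∈p-y; p─q⊆p; x∈p⇒∣p-x∣<∣p∣)
open import Data.Nat using (ℕ; zero; suc; _+_; _∸_; _≤_; _<_; s≤s; _≤?_)
open import Data.Nat.Properties
  using (+-suc; +-comm; ≤-trans; ≤-reflexive; <⇒≱; ≰⇒>; ≤-pred; n≤1+n; m≤n+m; +-monoʳ-<; m∸n+n≡m; module ≤-Reasoning)
open import Data.Product using (Σ; ∃; _×_; _,_; proj₁; proj₂)
open import Data.Sum using (_⊎_; inj₁; inj₂; [_,_]′)
open import Data.Vec using ([]; _∷_; lookup; map; tabulate; here; there)
open import Data.Vec.Properties using (lookup∘tabulate; lookup-map)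
open import Relation.Nullary using (¬_; Dec; yes; no)
open import Relation.Nullary.Decidable using (_×-dec_; _⊎-dec_; _→-dec_; ¬?; decidable-stable)
open import Relation.Binary.PropositionalEquality using (_≡_; _≢_; refl; sym; trans; cong; cong₂; subst; module ≡-Reasoning)

open import Defs

-- Finite sets

Disjoint : ∀ {n} → Subset n → Subset n → Set
Disjoint p q = ∀ x → x ∈ p → x ∉ q

Disjoint-tail : ∀ {n} {a b} {p q : Subset n} → Disjoint (a ∷ p) (b ∷ q) → Disjoint p q
Disjoint-tail d x x∈p x∈q = d (suc x) (there x∈p) (there x∈q)

∈∪ˡ : ∀ {n} {p q : Subset n} {x} → x ∈ p → x ∈ p ∪ q
∈∪ˡ x∈p = x∈p∪q⁺ (inj₁ x∈p)

∈∪ʳ : ∀ {n} {p q : Subset n} {x} → x ∈ q → x ∈ p ∪ q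
∈∪ʳ x∈q = x∈p∪q⁺ (inj₂ x∈q)

x∈p─q⇒x∉q : ∀ {n} (p q : Subset n) {x} → x ∈ p ─ q → x ∉ q
x∈p─q⇒x∉q (_ ∷ p) (true ∷ q) {zero} ()
x∈p─q⇒x∉q (_ ∷ p) (false ∷ q) {zero} _ ()
x∈p─q⇒x∉q (_ ∷ p) (_ ∷ q) {suc x} (there x∈p─q) (there x∈q) = x∈p─q⇒x∉q p q x∈p─q x∈q

∣p∪q∣≡∣p∣+∣q∣ : ∀ {n} (p q : Subset n) → Disjoint p q → ∣ p ∪ q ∣ ≡ ∣ p ∣ + ∣ q ∣
∣p∪q∣≡∣p∣+∣q∣ [] [] _ = refl
∣p∪q∣≡∣p∣+∣q∣ (true ∷ p) (true ∷ q) d = ⊥-elim (d zero here here)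
∣p∪q∣≡∣p∣+∣q∣ (true ∷ p) (false ∷ q) d = cong suc (∣p∪q∣≡∣p∣+∣q∣ p q (Disjoint-tail d))
∣p∪q∣≡∣p∣+∣q∣ (false ∷ p) (true ∷ q) d =
  trans (cong suc (∣p∪q∣≡∣p∣+∣q∣ p q (Disjoint-tail d))) (sym (+-suc ∣ p ∣ ∣ q ∣))
∣p∪q∣≡∣p∣+∣q∣ (false ∷ p) (false ∷ q) d = ∣p∪q∣≡∣p∣+∣q∣ p q (Disjoint-tail d)

∣p∪⁅x⁆∣≡1+∣p∣ : ∀ {n} (p : Subset n) {x} → x ∉ p → ∣ p ∪ ⁅ x ⁆ ∣ ≡ suc ∣ p ∣
∣p∪⁅x⁆∣≡1+∣p∣ p {x} x∉p = begin
  ∣ p ∪ ⁅ x ⁆ ∣       ≡⟨ ∣p∪q∣≡∣p∣+∣q∣ p ⁅ x ⁆ (λ y y∈p y∈⁅x⁆ → x∉p (subst (_∈ p) (x∈⁅y⁆⇒x≡y x y∈⁅x⁆) y∈p)) ⟩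
  ∣ p ∣ + ∣ ⁅ x ⁆ ∣   ≡⟨ cong (∣ p ∣ +_) (∣⁅x⁆∣≡1 x) ⟩
  ∣ p ∣ + 1           ≡⟨ +-comm ∣ p ∣ 1 ⟩
  suc ∣ p ∣           ∎
  where open ≡-Reasoning

x∈p∪q∧x∉p⇒x∈q : ∀ {n} (p q : Subset n) {x} → x ∈ p ∪ q → x ∉ p → x ∈ q
x∈p∪q∧x∉p⇒x∈q p q x∈p∪q x∉p = [ (λ x∈p → ⊥-elim (x∉p x∈p)) , (λ x∈q → x∈q) ]′ (x∈p∪q⁻ p q x∈p∪q)

x∈p∪⁅y⁆⁻ : ∀ {n} (p : Subset n) y {x} → x ∈ p ∪ ⁅ y ⁆ → x ∈ p ⊎ x ≡ y
x∈p∪⁅y⁆⁻ p y x∈ = [ inj₁ , (λ x∈⁅y⁆ → inj₂ (x∈⁅y⁆⇒x≡y y x∈⁅y⁆)) ]′ (x∈p∪q⁻ p ⁅ y ⁆ x∈)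

∪-monoʳ-⊆ : ∀ {n} (p : Subset n) {q r} → q ⊆ r → p ∪ q ⊆ p ∪ r
∪-monoʳ-⊆ p {q} q⊆r x∈ = [ ∈∪ˡ , (λ x∈q → ∈∪ʳ (q⊆r x∈q)) ]′ (x∈p∪q⁻ p q x∈)

p⊆q⇒p∪[q─p]≡q : ∀ {n} {p q : Subset n} → p ⊆ q → p ∪ (q ─ p) ≡ q
p⊆q⇒p∪[q─p]≡q {p = p} {q} p⊆q = ⊆-antisym (λ x∈ → [ p⊆q , p─q⊆p q p ]′ (x∈p∪q⁻ p (q ─ p) x∈)) q⊆p∪[q─p]
  where
  q⊆p∪[q─p] : q ⊆ p ∪ (q ─ p)
  q⊆p∪[q─p] {x} x∈q with x ∈? p
  ... | yes x∈p = ∈∪ˡ x∈p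
  ... | no x∉p = ∈∪ʳ (x∈p∧x∉q⇒x∈p─q x∈q x∉p)

y∉p⇒p∪[q-y]≡[p∪q]-y : ∀ {n} (p q : Subset n) {y} → y ∉ p → p ∪ (q - y) ≡ (p ∪ q) - y
y∉p⇒p∪[q-y]≡[p∪q]-y p q {y} y∉p = ⊆-antisym
  (λ x∈ → [ (λ x∈p → x∈p∧x≢y⇒x∈p-y (∈∪ˡ x∈p) λ { refl → y∉p x∈p }) ,
            (λ x∈q-y → x∈p∧x∉q⇒x∈p─q (∈∪ʳ (p─q⊆p q ⁅ y ⁆ x∈q-y)) (x∈p─q⇒x∉q q ⁅ y ⁆ x∈q-y)) ]′
          (x∈p∪q⁻ p (q - y) x∈))
  (λ x∈ → [ ∈∪ˡ , (λ x∈q → ∈∪ʳ (x∈p∧x∉q⇒x∈p─q x∈q (x∈p─q⇒x∉q (p ∪ q) ⁅ y ⁆ x∈))) ]′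
          (x∈p∪q⁻ p q (p─q⊆p (p ∪ q) ⁅ y ⁆ x∈)))

p⊆q⊎∃[x]x∈p∧x∉q : ∀ {n} (p q : Subset n) → p ⊆ q ⊎ ∃ λ x → x ∈ p × x ∉ q
p⊆q⊎∃[x]x∈p∧x∉q p q with any? (λ x → (x ∈? p) ×-dec ¬? (x ∈? q))
... | yes witness = inj₂ witness
... | no none = inj₁ p⊆q
  where
  p⊆q : p ⊆ q
  p⊆q {x} x∈p with x ∈? q
  ... | yes x∈q = x∈q
  ... | no x∉q = ⊥-elim (none (x , x∈p , x∉q))

∣p∣<∣q∣⇒∃[x]x∈q∧x∉p : ∀ {n} {p q : Subset n} → ∣ p ∣ < ∣ q ∣ → ∃ λ x → x ∈ q × x ∉ p
∣p∣<∣q∣⇒∃[x]x∈q∧x∉p {p = p} {q} ∣p∣<∣q∣ =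
  [ (λ (q⊆p : q ⊆ p) → ⊥-elim (<⇒≱ ∣p∣<∣q∣ (p⊆q⇒∣p∣≤∣q∣ q⊆p))) , (λ witness → witness) ]′ (p⊆q⊎∃[x]x∈p∧x∉q q p)

p⊆q∧∣q∣≤∣p∣⇒p≡q : ∀ {n} {p q : Subset n} → p ⊆ q → ∣ q ∣ ≤ ∣ p ∣ → p ≡ q
p⊆q∧∣q∣≤∣p∣⇒p≡q {p = p} {q} p⊆q ∣q∣≤∣p∣ =
  [ (λ (q⊆p : q ⊆ p) → ⊆-antisym p⊆q q⊆p) ,
    (λ (x , x∈q , x∉p) → ⊥-elim (<⇒≱ (p⊂q⇒∣p∣<∣q∣ (p⊆q , x , x∈q , x∉p)) ∣q∣≤∣p∣)) ]′
    (p⊆q⊎∃[x]x∈p∧x∉q q p)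

disjoint?-sound : ∀ {n} (p q : Subset n) → disjoint? p q ≡ true → Disjoint p q
disjoint?-sound (true ∷ p) (true ∷ q) ()
disjoint?-sound (true ∷ p) (false ∷ q) _ zero _ ()
disjoint?-sound (false ∷ p) (_ ∷ q) _ zero ()
disjoint?-sound (true ∷ p) (false ∷ q) eq (suc x) (there i) (there j) = disjoint?-sound p q eq x i j
disjoint?-sound (false ∷ p) (_ ∷ q) eq (suc x) (there i) (there j) = disjoint?-sound p q eq x i j

disjoint?-complete : ∀ {n} (p q : Subset n) → Disjoint p q → disjoint? p q ≡ true
disjoint?-complete [] [] _ = refl
disjoint?-complete (true ∷ p) (true ∷ q) d = ⊥-elim (d zero here here)
disjoint?-complete (true ∷ p) (false ∷ q) d = disjoint?-complete p q (Disjoint-tail d)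
disjoint?-complete (false ∷ p) (_ ∷ q) d = disjoint?-complete p q (Disjoint-tail d)

module _ {n} (F : Subset n → Bool) (X Y : Subset n) where

  conF⇒Disjoint×Feas : T (conF F X Y) → Disjoint X Y × T (F (X ∪ Y))
  conF⇒Disjoint×Feas t with disjoint? X Y in eq
  ... | true = disjoint?-sound X Y eq , t

  Disjoint×Feas⇒conF : Disjoint X Y → T (F (X ∪ Y)) → T (conF F X Y)
  Disjoint×Feas⇒conF d t with disjoint? X Y | disjoint?-complete X Y d
  ... | true | _ = t

-- Signs

Signed : Sign → Set
Signed s = s ≡ pos ⊎ s ≡ neg

zer≢one : zer ≢ one
zer≢one ()

signed≢zer : ∀ {s} → Signed s → s ≢ zer
signed≢zer (inj₁ refl) ()
signed≢zer (inj₂ refl) ()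

signed≢one : ∀ {s} → Signed s → s ≢ one
signed≢one (inj₁ refl) ()
signed≢one (inj₂ refl) ()

negˢ-signed : ∀ {s} → Signed s → Signed (negˢ s)
negˢ-signed (inj₁ refl) = inj₂ refl
negˢ-signed (inj₂ refl) = inj₁ refl

sign-cases : ∀ s → Signed s ⊎ (s ≡ zer ⊎ s ≡ one)
sign-cases zer = inj₂ (inj₁ refl)
sign-cases pos = inj₁ (inj₁ refl)
sign-cases neg = inj₁ (inj₂ refl)
sign-cases one = inj₂ (inj₂ refl)

_<ˢ?_ : ∀ a b → Dec (a <ˢ b)
zer <ˢ? zer = no λ ()
zer <ˢ? pos = yes 0<+
zer <ˢ? neg = yes 0<-
zer <ˢ? one = yes 0<1
pos <ˢ? one = yes +<1
neg <ˢ? one = yes -<1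
pos <ˢ? zer = no λ ()
pos <ˢ? pos = no λ ()
pos <ˢ? neg = no λ ()
neg <ˢ? zer = no λ ()
neg <ˢ? pos = no λ ()
neg <ˢ? neg = no λ ()
one <ˢ? _ = no λ ()

Separated : Sign → Sign → Set
Separated a b = (a ≡ pos × b ≡ neg) ⊎ (a ≡ neg × b ≡ pos)

Separated-signedˡ : ∀ {a b} → Separated a b → Signed a
Separated-signedˡ (inj₁ (a≡pos , _)) = inj₁ a≡pos
Separated-signedˡ (inj₂ (a≡neg , _)) = inj₂ a≡neg

Separated-signedʳ : ∀ {a b} → Separated a b → Signed b
Separated-signedʳ (inj₁ (_ , b≡neg)) = inj₂ b≡neg
Separated-signedʳ (inj₂ (_ , b≡pos)) = inj₁ b≡pos

Separated-cong : ∀ {a b a' b'} → a ≡ a' → b ≡ b' → Separated a b → Separated a' b'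
Separated-cong refl refl s = s

zer-not-Separated : ∀ {a b} → a ≡ zer → ¬ Separated a b
zer-not-Separated a≡zer s = signed≢zer (Separated-signedˡ s) a≡zer

-- the value (α ∘ β)(e) at a point e of Γ(C) ∪ ξ(C)
_·ˢ_ : Sign → Sign → Sign
a ·ˢ b with a <ˢ? b
... | yes _ = b
... | no _ = a

·ˢ-< : ∀ {a b} → a <ˢ b → a ·ˢ b ≡ b
·ˢ-< {a} {b} a<b with a <ˢ? b
... | yes _ = refl
... | no a≮b = ⊥-elim (a≮b a<b)

·ˢ-≮ : ∀ {a b} → ¬ a <ˢ b → a ·ˢ b ≡ a
·ˢ-≮ {a} {b} a≮b with a <ˢ? b
... | yes a<b = ⊥-elim (a≮b a<b)
... | no _ = refl

·ˢ≡zer⇒ : ∀ a b → a ·ˢ b ≡ zer → a ≡ zer × b ≡ zer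
·ˢ≡zer⇒ zer zer _ = refl , refl
·ˢ≡zer⇒ zer pos ()
·ˢ≡zer⇒ zer neg ()
·ˢ≡zer⇒ zer one ()
·ˢ≡zer⇒ pos zer ()
·ˢ≡zer⇒ pos pos ()
·ˢ≡zer⇒ pos neg ()
·ˢ≡zer⇒ pos one ()
·ˢ≡zer⇒ neg zer ()
·ˢ≡zer⇒ neg pos ()
·ˢ≡zer⇒ neg neg ()
·ˢ≡zer⇒ neg one ()
·ˢ≡zer⇒ one zer ()
·ˢ≡zer⇒ one pos ()
·ˢ≡zer⇒ one neg ()
·ˢ≡zer⇒ one one ()

·ˢ-separated : ∀ {a b} → Separated a b → Signed (a ·ˢ b)
·ˢ-separated (inj₁ (refl , refl)) = inj₁ refl
·ˢ-separated (inj₂ (refl , refl)) = inj₂ refl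

-- Interval greedoids

module IntervalGreedoidTheory {n : ℕ} {E : Fin n → Set} {F : Subset n → Bool}
                              (ig : Greedoid.IsIntervalGreedoid E F) where
  open Greedoid E F
  open IsIntervalGreedoid ig

  Feas? : ∀ X → Dec (Feas X)
  Feas? X = T? (F X)

  InΓ? : ∀ X e → Dec (InΓ X e)
  InΓ? X e with e ∈? X | Feas? (X ∪ ⁅ e ⁆)
  ... | yes e∈X | _ = no λ (_ , e∉X , _) → e∉X e∈X
  ... | no e∉X | yes f = yes (ground _ f e (∈∪ʳ (x∈⁅x⁆ e)) , e∉X , f)
  ... | no _ | no ¬f = no λ (_ , _ , f) → ¬f f

  ∼? : ∀ X Y → Dec (X ∼ Y)
  ∼? X Y = all? λ e → (InΓ? X e →-dec InΓ? Y e) ×-dec (InΓ? Y e →-dec InΓ? X e)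

  Inξ? : ∀ X e → Dec (Inξ X e)
  Inξ? X e = anySubset? λ X' → Feas? X' ×-dec (∼? X' X ×-dec (e ∈? X'))

  ∼-refl : ∀ {X} → X ∼ X
  ∼-refl e = (λ g → g) , (λ g → g)

  ∼-sym : ∀ {X Y} → X ∼ Y → Y ∼ X
  ∼-sym X∼Y e = proj₂ (X∼Y e) , proj₁ (X∼Y e)

  ∼-trans : ∀ {X Y Z} → X ∼ Y → Y ∼ Z → X ∼ Z
  ∼-trans X∼Y Y∼Z e = (λ g → proj₁ (Y∼Z e) (proj₁ (X∼Y e) g)) , (λ g → proj₂ (X∼Y e) (proj₂ (Y∼Z e) g))

  ξ-self : ∀ {X e} → Feas X → e ∈ X → Inξ X e
  ξ-self {X} f e∈X = X , f , ∼-refl , e∈X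

  ξ-resp-∼ : ∀ {X Y e} → X ∼ Y → Inξ X e → Inξ Y e
  ξ-resp-∼ X∼Y (X' , f , X'∼X , e∈X') = X' , f , ∼-trans X'∼X X∼Y , e∈X'

  Γ-ξ-disjoint : ∀ {X e} → InΓ X e → ¬ Inξ X e
  Γ-ξ-disjoint g (X' , _ , X'∼X , e∈X') = proj₁ (proj₂ (proj₂ (X'∼X _) g)) e∈X'

  InΓ-stable : ∀ {X e} → ¬ ¬ InΓ X e → InΓ X e
  InΓ-stable {X} {e} = decidable-stable (InΓ? X e)

  rank-bound : ∀ {A V} → Feas A → Feas V → (∀ e → e ∈ V → ¬ InΓ A e) → ∣ V ∣ ≤ ∣ A ∣
  rank-bound {A} {V} fA fV V∩ΓA=∅ with ∣ V ∣ ≤? ∣ A ∣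
  ... | yes ∣V∣≤∣A∣ = ∣V∣≤∣A∣
  ... | no ∣V∣≰∣A∣ with IG2 V A fV fA (≰⇒> ∣V∣≰∣A∣)
  ...   | x , x∈V , x∉A , fAx = ⊥-elim (V∩ΓA=∅ x x∈V (ground _ fAx x (∈∪ʳ (x∈⁅x⁆ x)) , x∉A , fAx))

  ξ-rank-bound : ∀ {A V} → Feas A → Feas V → (∀ e → e ∈ V → Inξ A e) → ∣ V ∣ ≤ ∣ A ∣
  ξ-rank-bound fA fV V⊆ξA = rank-bound fA fV λ e e∈V g → Γ-ξ-disjoint g (V⊆ξA e e∈V)

  -- A continuation of one of A, W missing from the other yields a feasible set too large for rank-bound.
  ⊆ξ⇒∼ : ∀ {A W} → Feas A → Feas W → (∀ e → e ∈ W → Inξ A e) → ∣ A ∣ ≤ ∣ W ∣ → W ∼ A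
  ⊆ξ⇒∼ {A} {W} fA fW W⊆ξA ∣A∣≤∣W∣ e = ΓW⊆ΓA , ΓA⊆ΓW
    where
    ΓW⊆ΓA : ∀ {e} → InΓ W e → InΓ A e
    ΓW⊆ΓA {e} (_ , e∉W , fWe) = InΓ-stable λ e∉ΓA →
      <⇒≱ (≤-trans (s≤s ∣A∣≤∣W∣) (≤-reflexive (sym (∣p∪⁅x⁆∣≡1+∣p∣ W e∉W))))
          (rank-bound fA fWe λ u u∈We → [ (λ u∈W g → Γ-ξ-disjoint g (W⊆ξA u u∈W)) ,
                                          (λ { refl → e∉ΓA }) ]′ (x∈p∪⁅y⁆⁻ W e u∈We))

    ΓA⊆ΓW : ∀ {e} → InΓ A e → InΓ W e
    ΓA⊆ΓW {e} (_ , e∉A , fAe) = InΓ-stable λ e∉ΓW →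
      <⇒≱ (≤-trans (s≤s (ξ-rank-bound fA fW W⊆ξA)) (≤-reflexive (sym (∣p∪⁅x⁆∣≡1+∣p∣ A e∉A))))
          (rank-bound fW fAe λ u u∈Ae → [ (λ u∈A g → proj₁ (proj₂ (ΓW⊆ΓA g)) u∈A) ,
                                          (λ { refl → e∉ΓW }) ]′ (x∈p∪⁅y⁆⁻ A e u∈Ae))

  extendByOne : ∀ {U V} → Feas U → Feas V → ∣ V ∣ < ∣ U ∣ →
                ∃ λ x → x ∈ U × Feas (V ∪ ⁅ x ⁆) × ∣ V ∪ ⁅ x ⁆ ∣ ≡ suc ∣ V ∣
  extendByOne {U} {V} fU fV ∣V∣<∣U∣ =
    let x , x∈U , x∉V , fVx = IG2 U V fU fV ∣V∣<∣U∣
    in x , x∈U , fVx , ∣p∪⁅x⁆∣≡1+∣p∣ V x∉V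

  extendWithin : ∀ (S : Fin n → Set) {U} → Feas U → (∀ e → e ∈ U → S e) →
                 ∀ k {V} → Feas V → (∀ e → e ∈ V → S e) → k + ∣ V ∣ ≤ ∣ U ∣ →
                 ∃ λ V' → Feas V' × V ⊆ V' × (∀ e → e ∈ V' → S e) × ∣ V' ∣ ≡ k + ∣ V ∣
  extendWithin S fU U⊆S zero {V} fV V⊆S _ = V , fV , (λ e∈V → e∈V) , V⊆S , refl
  extendWithin S {U} fU U⊆S (suc k) {V} fV V⊆S size =
    let x , x∈U , fVx , ∣Vx∣≡1+∣V∣ = extendByOne fU fV (≤-trans (s≤s (m≤n+m ∣ V ∣ k)) size)
        k+∣Vx∣≡1+k+∣V∣ = trans (cong (k +_) ∣Vx∣≡1+∣V∣) (+-suc k ∣ V ∣)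
        Vx⊆S : ∀ e → e ∈ V ∪ ⁅ x ⁆ → S e
        Vx⊆S e e∈Vx = [ V⊆S e , (λ { refl → U⊆S x x∈U }) ]′ (x∈p∪⁅y⁆⁻ V x e∈Vx)
        V' , fV' , Vx⊆V' , V'⊆S , ∣V'∣ =
          extendWithin S fU U⊆S k fVx Vx⊆S (≤-trans (≤-reflexive k+∣Vx∣≡1+k+∣V∣) size)
    in V' , fV' , (λ e∈V → Vx⊆V' (∈∪ˡ e∈V)) , V'⊆S , trans ∣V'∣ k+∣Vx∣≡1+k+∣V∣

  extendToFlat : ∀ {A V} → Feas A → Feas V → (∀ e → e ∈ V → Inξ A e) →
                 ∃ λ V' → Feas V' × V ⊆ V' × (∀ e → e ∈ V' → Inξ A e) × V' ∼ A
  extendToFlat {A} {V} fA fV V⊆ξA =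
    let k+∣V∣≡∣A∣ = m∸n+n≡m (ξ-rank-bound fA fV V⊆ξA)
        V' , fV' , V⊆V' , V'⊆ξA , ∣V'∣ =
          extendWithin (Inξ A) fA (λ e → ξ-self fA) (∣ A ∣ ∸ ∣ V ∣) fV V⊆ξA (≤-reflexive k+∣V∣≡∣A∣)
    in V' , fV' , V⊆V' , V'⊆ξA , ⊆ξ⇒∼ fA fV' V'⊆ξA (≤-reflexive (sym (trans ∣V'∣ k+∣V∣≡∣A∣)))

  -- Grow V inside U to one element short of U; the element it misses is removable.
  removable-outside : ∀ {V U} → Feas V → Feas U → V ⊆ U → ∣ V ∣ < ∣ U ∣ →
                      ∃ λ y → y ∈ U × y ∉ V × Feas (U - y)
  removable-outside {V} {U} fV fU V⊆U ∣V∣<∣U∣ =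
    let k = ∣ U ∣ ∸ suc ∣ V ∣
        1+k+∣V∣≡∣U∣ = trans (sym (+-suc k ∣ V ∣)) (m∸n+n≡m ∣V∣<∣U∣)
        W , fW , V⊆W , W⊆U , ∣W∣≡k+∣V∣ =
          extendWithin (_∈ U) fU (λ _ e∈U → e∈U) k fV (λ _ → V⊆U) (≤-trans (n≤1+n _) (≤-reflexive 1+k+∣V∣≡∣U∣))
        1+∣W∣≡∣U∣ = trans (cong suc ∣W∣≡k+∣V∣) 1+k+∣V∣≡∣U∣
        y , y∈U , y∉W = ∣p∣<∣q∣⇒∃[x]x∈q∧x∉p (≤-reflexive 1+∣W∣≡∣U∣)
        W⊆U-y : W ⊆ U - y
        W⊆U-y e∈W = x∈p∧x≢y⇒x∈p-y (W⊆U _ e∈W) λ { refl → y∉W e∈W }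
        W≡U-y = p⊆q∧∣q∣≤∣p∣⇒p≡q W⊆U-y (≤-pred (≤-trans (x∈p⇒∣p-x∣<∣p∣ y∈U) (≤-reflexive (sym 1+∣W∣≡∣U∣))))
    in y , y∈U , (λ y∈V → y∉W (V⊆W y∈V)) , subst Feas W≡U-y fW

  cov-feasible : ∀ {Y} v → CovOf Y v → Feas Y
  cov-feasible _ = proj₁

  cov-signed : ∀ {Y} v {e} → CovOf Y v → InΓ Y e → Signed (lookup v e)
  cov-signed _ {e} (_ , c) = proj₁ (c e)

  cov-zer : ∀ {Y} v {e} → CovOf Y v → Inξ Y e → lookup v e ≡ zer
  cov-zer _ {e} (_ , c) = proj₁ (proj₂ (c e))

  cov-one : ∀ {Y} v {e} → CovOf Y v → ¬ InΓ Y e → ¬ Inξ Y e → lookup v e ≡ one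
  cov-one _ {e} (_ , c) = proj₂ (proj₂ (c e))

  signed⇒InΓ : ∀ {Y} v {e} → CovOf Y v → Signed (lookup v e) → InΓ Y e
  signed⇒InΓ {Y} v {e} c s with InΓ? Y e | Inξ? Y e
  ... | yes g | _ = g
  ... | no _ | yes x = ⊥-elim (signed≢zer s (cov-zer v c x))
  ... | no ¬g | no ¬x = ⊥-elim (signed≢one s (cov-one v c ¬g ¬x))

  zer⇒Inξ : ∀ {Y} v {e} → CovOf Y v → lookup v e ≡ zer → Inξ Y e
  zer⇒Inξ {Y} v {e} c z with InΓ? Y e | Inξ? Y e
  ... | _ | yes x = x
  ... | yes g | no _ = ⊥-elim (signed≢zer (cov-signed v c g) z)
  ... | no ¬g | no ¬x = ⊥-elim (zer≢one (trans (sym z) (cov-one v c ¬g ¬x)))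

  CovOf⇒∼ : ∀ {Y Y'} v → CovOf Y v → CovOf Y' v → Y ∼ Y'
  CovOf⇒∼ v c c' e = (λ g → signed⇒InΓ v c' (cov-signed v c g)) , (λ g → signed⇒InΓ v c (cov-signed v c' g))

  CovOf-resp-∼ : ∀ {Y Y'} v → Y ∼ Y' → Feas Y' → CovOf Y v → CovOf Y' v
  CovOf-resp-∼ v Y∼Y' fY' c = fY' , λ e →
    (λ g → cov-signed v c (proj₂ (Y∼Y' e) g)) ,
    (λ x → cov-zer v c (ξ-resp-∼ (∼-sym Y∼Y') x)) ,
    (λ ¬g ¬x → cov-one v c (λ g → ¬g (proj₁ (Y∼Y' e) g)) (λ x → ¬x (ξ-resp-∼ Y∼Y' x)))

  CovOf-neg : ∀ {Y} v → CovOf Y v → CovOf Y (map negˢ v)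
  CovOf-neg v c = cov-feasible v c , λ e →
    (λ g → subst Signed (sym (lookup-map e negˢ v)) (negˢ-signed (cov-signed v c g))) ,
    (λ x → trans (lookup-map e negˢ v) (cong negˢ (cov-zer v c x))) ,
    (λ ¬g ¬x → trans (lookup-map e negˢ v) (cong negˢ (cov-one v c ¬g ¬x)))

  covectorValue : Subset n → (Fin n → Sign) → Fin n → Sign
  covectorValue Y s e with InΓ? Y e | Inξ? Y e
  ... | yes _ | _ = s e
  ... | no _ | yes _ = zer
  ... | no _ | no _ = one

  covectorWith : ∀ {Y} → Feas Y → (s : Fin n → Sign) → (∀ e → InΓ Y e → Signed (s e)) →
                 Σ (SignVec n) λ v → CovOf Y v × (∀ e → InΓ Y e → lookup v e ≡ s e)
  covectorWith {Y} fY s s-signed = v , (fY , λ e → onΓ e , onξ e , elsewhere e) , agree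
    where
    v : SignVec n
    v = tabulate (covectorValue Y s)

    agree : ∀ e → InΓ Y e → lookup v e ≡ s e
    agree e g rewrite lookup∘tabulate (covectorValue Y s) e with InΓ? Y e
    ... | yes _ = refl
    ... | no ¬g = ⊥-elim (¬g g)

    onΓ : ∀ e → InΓ Y e → Signed (lookup v e)
    onΓ e g = subst Signed (sym (agree e g)) (s-signed e g)

    onξ : ∀ e → Inξ Y e → lookup v e ≡ zer
    onξ e x rewrite lookup∘tabulate (covectorValue Y s) e with InΓ? Y e | Inξ? Y e
    ... | yes g | _ = ⊥-elim (Γ-ξ-disjoint g x)
    ... | no _ | yes _ = refl
    ... | no _ | no ¬x = ⊥-elim (¬x x)

    elsewhere : ∀ e → ¬ InΓ Y e → ¬ Inξ Y e → lookup v e ≡ one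
    elsewhere e ¬g ¬x rewrite lookup∘tabulate (covectorValue Y s) e with InΓ? Y e | Inξ? Y e
    ... | yes g | _ = ⊥-elim (¬g g)
    ... | no _ | yes x = ⊥-elim (¬x x)
    ... | no _ | no _ = refl

  ProductAt : Subset n → Fin n → Sign → Sign → Sign → Set
  ProductAt C e a b c = ((InΓ C e ⊎ Inξ C e) → (a <ˢ b → c ≡ b) × (¬ (a <ˢ b) → c ≡ a))
                      × (¬ (InΓ C e ⊎ Inξ C e) → c ≡ one)

  ProductOn : Subset n → SignVec n → SignVec n → SignVec n → Set
  ProductOn C α β γ = ∀ e → ProductAt C e (lookup α e) (lookup β e) (lookup γ e)

  ProductAt-inside : ∀ {C e a b c} → ProductAt C e a b c → InΓ C e ⊎ Inξ C e → c ≡ a ·ˢ b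
  ProductAt-inside {a = a} {b} p inside with a <ˢ? b
  ... | yes a<b = proj₁ (proj₁ p inside) a<b
  ... | no a≮b = proj₂ (proj₁ p inside) a≮b

  ProductAt-≢one : ∀ {C e a b c} → ProductAt C e a b c → c ≢ one → c ≡ a ·ˢ b
  ProductAt-≢one {C} {e} p c≢one with InΓ? C e ⊎-dec Inξ? C e
  ... | yes inside = ProductAt-inside p inside
  ... | no outside = ⊥-elim (c≢one (proj₂ p outside))

  ProductAt-zer : ∀ {C e a b c} → ProductAt C e a b c → c ≡ zer → a ≡ zer × b ≡ zer
  ProductAt-zer p refl = ·ˢ≡zer⇒ _ _ (sym (ProductAt-≢one p zer≢one))

  ProductAt-inside-zer : ∀ {C e a b c} → ProductAt C e a b c → InΓ C e ⊎ Inξ C e →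
                         a ≡ zer → b ≡ zer → c ≡ zer
  ProductAt-inside-zer p inside refl refl = ProductAt-inside p inside

  productValue : Subset n → SignVec n → SignVec n → Fin n → Sign
  productValue C α β e with InΓ? C e ⊎-dec Inξ? C e
  ... | yes _ = lookup α e ·ˢ lookup β e
  ... | no _ = one

  product : Subset n → SignVec n → SignVec n → SignVec n
  product C α β = tabulate (productValue C α β)

  product-ProductOn : ∀ C α β → ProductOn C α β (product C α β)
  product-ProductOn C α β e rewrite lookup∘tabulate (productValue C α β) e with InΓ? C e ⊎-dec Inξ? C e
  ... | yes inside = (λ _ → ·ˢ-< , ·ˢ-≮) , (λ outside → ⊥-elim (outside inside))
  ... | no outside = (λ inside → ⊥-elim (outside inside)) , (λ _ → refl)

  product-zer-on-join : ∀ {Xa Xb C} α β → CovOf Xa α → CovOf Xb β → IsJoin Xa Xb C →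
                        ∀ u → u ∈ C → lookup (product C α β) u ≡ zer
  product-zer-on-join {C = C} α β cα cβ (fC , C⊆ξ , _) u u∈C =
    ProductAt-inside-zer (product-ProductOn C α β u) (inj₂ (ξ-self fC u∈C))
      (cov-zer α cα (proj₁ (C⊆ξ u u∈C))) (cov-zer β cβ (proj₂ (C⊆ξ u u∈C)))

  -- supp (α ∘ β) = supp α ∨ supp β: a point of W = supp (α ∘ β) outside C would extend C inside ξ(Xa) ∩ ξ(Xb).
  product-support : ∀ {Xa Xb C W} α β → CovOf Xa α → CovOf Xb β → IsJoin Xa Xb C →
                    CovOf W (product C α β) → CovOf C (product C α β)
  product-support {Xa} {Xb} {C} {W} α β cα cβ join@(fC , C⊆ξ , maximal) cW = CovOf-resp-∼ δ (∼-sym C∼W) fC cW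
    where
    δ : SignVec n
    δ = product C α β

    fW : Feas W
    fW = cov-feasible δ cW

    W∩ΓC=∅ : ∀ u → u ∈ W → ¬ InΓ C u
    W∩ΓC=∅ u u∈W (_ , u∉C , fCu) = u∉C (maximal (C ∪ ⁅ u ⁆) fCu ∈∪ˡ Cu⊆ξ (∈∪ʳ (x∈⁅x⁆ u)))
      where
      αβ≡zer : lookup α u ≡ zer × lookup β u ≡ zer
      αβ≡zer = ProductAt-zer (product-ProductOn C α β u) (cov-zer δ cW (ξ-self fW u∈W))
      Cu⊆ξ : ∀ e → e ∈ C ∪ ⁅ u ⁆ → Inξ Xa e × Inξ Xb e
      Cu⊆ξ e e∈Cu = [ C⊆ξ e , (λ { refl → zer⇒Inξ α cα (proj₁ αβ≡zer) , zer⇒Inξ β cβ (proj₂ αβ≡zer) }) ]′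
                      (x∈p∪⁅y⁆⁻ C u e∈Cu)

    C∼W : C ∼ W
    C∼W = ⊆ξ⇒∼ fW fC (λ u u∈C → zer⇒Inξ δ cW (product-zer-on-join α β cα cβ join u u∈C))
                      (rank-bound fC fW W∩ΓC=∅)

-- Contraction

module Contraction {n : ℕ} {E : Fin n → Set} {F : Subset n → Bool}
                   (ig : Greedoid.IsIntervalGreedoid E F) {X : Subset n} (fX : T (F X)) where
  open Greedoid E F
  open IsIntervalGreedoid ig
  open IntervalGreedoidTheory ig
  module G/X = Greedoid (conE F X) (conF F X)

  disjoint : ∀ {Y} → G/X.Feas Y → Disjoint X Y
  disjoint {Y} fY = proj₁ (conF⇒Disjoint×Feas F X Y fY)

  ∪-feasible : ∀ {Y} → G/X.Feas Y → Feas (X ∪ Y)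
  ∪-feasible {Y} fY = proj₂ (conF⇒Disjoint×Feas F X Y fY)

  feasible/X : ∀ {Y} → Disjoint X Y → Feas (X ∪ Y) → G/X.Feas Y
  feasible/X {Y} = Disjoint×Feas⇒conF F X Y

  ∪⁅⁆-feasible : ∀ {Y e} → G/X.Feas (Y ∪ ⁅ e ⁆) → Feas ((X ∪ Y) ∪ ⁅ e ⁆)
  ∪⁅⁆-feasible {Y} {e} fYe = subst Feas (sym (∪-assoc X Y ⁅ e ⁆)) (∪-feasible fYe)

  feasible/X-∪⁅⁆ : ∀ {Y e} → G/X.Feas Y → e ∉ X → Feas ((X ∪ Y) ∪ ⁅ e ⁆) → G/X.Feas (Y ∪ ⁅ e ⁆)
  feasible/X-∪⁅⁆ {Y} {e} fY e∉X fXYe = feasible/X X∩Ye=∅ (subst Feas (∪-assoc X Y ⁅ e ⁆) fXYe)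
    where
    X∩Ye=∅ : Disjoint X (Y ∪ ⁅ e ⁆)
    X∩Ye=∅ u u∈X u∈Ye = [ disjoint fY u u∈X , (λ { refl → e∉X u∈X }) ]′ (x∈p∪⁅y⁆⁻ Y e u∈Ye)

  feasible─X : ∀ {V} → Feas V → X ⊆ V → G/X.Feas (V ─ X)
  feasible─X {V} fV X⊆V =
    feasible/X (λ u u∈X u∈V─X → x∈p─q⇒x∉q V X u∈V─X u∈X) (subst Feas (sym (p⊆q⇒p∪[q─p]≡q X⊆V)) fV)

  ∪[─X]-∼ : ∀ {V W} → X ⊆ V → V ∼ W → (X ∪ (V ─ X)) ∼ W
  ∪[─X]-∼ X⊆V = subst (_∼ _) (sym (p⊆q⇒p∪[q─p]≡q X⊆V))

  conE⇒∉X : ∀ {e} → conE F X e → e ∉ X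
  conE⇒∉X (Y , fY , e∈Y) e∈X = disjoint fY _ e∈X e∈Y

  Γ/X⇒Γ : ∀ {Y e} → G/X.InΓ Y e → InΓ (X ∪ Y) e
  Γ/X⇒Γ {Y} {e} (e∈E/X , e∉Y , fYe) =
    ground _ fXYe e (∈∪ʳ (x∈⁅x⁆ e)) , (λ e∈XY → [ conE⇒∉X e∈E/X , e∉Y ]′ (x∈p∪q⁻ X Y e∈XY)) , fXYe
    where
    fXYe : Feas ((X ∪ Y) ∪ ⁅ e ⁆)
    fXYe = ∪⁅⁆-feasible fYe

  Γ⇒Γ/X : ∀ {Y e} → G/X.Feas Y → InΓ (X ∪ Y) e → G/X.InΓ Y e
  Γ⇒Γ/X {Y} {e} fY (_ , e∉XY , fXYe) = (Y ∪ ⁅ e ⁆ , fYe , ∈∪ʳ (x∈⁅x⁆ e)) , (λ e∈Y → e∉XY (∈∪ʳ e∈Y)) , fYe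
    where
    fYe : G/X.Feas (Y ∪ ⁅ e ⁆)
    fYe = feasible/X-∪⁅⁆ fY (λ e∈X → e∉XY (∈∪ˡ e∈X)) fXYe

  ∼/X⇒∼ : ∀ {Y Y'} → G/X.Feas Y → G/X.Feas Y' → G/X._∼_ Y Y' → (X ∪ Y) ∼ (X ∪ Y')
  ∼/X⇒∼ fY fY' Y∼Y' e = (λ g → Γ/X⇒Γ (proj₁ (Y∼Y' e) (Γ⇒Γ/X fY g))) ,
                        (λ g → Γ/X⇒Γ (proj₂ (Y∼Y' e) (Γ⇒Γ/X fY' g)))

  ∼⇒∼/X : ∀ {Y Y'} → G/X.Feas Y → G/X.Feas Y' → (X ∪ Y) ∼ (X ∪ Y') → G/X._∼_ Y Y'
  ∼⇒∼/X fY fY' XY∼XY' e = (λ g → Γ⇒Γ/X fY' (proj₁ (XY∼XY' e) (Γ/X⇒Γ g))) ,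
                          (λ g → Γ⇒Γ/X fY (proj₂ (XY∼XY' e) (Γ/X⇒Γ g)))

  ξ/X⇒ξ : ∀ {Y e} → G/X.Feas Y → G/X.Inξ Y e → Inξ (X ∪ Y) e
  ξ/X⇒ξ fY (Y' , fY' , Y'∼Y , e∈Y') = X ∪ Y' , ∪-feasible fY' , ∼/X⇒∼ fY' fY Y'∼Y , ∈∪ʳ e∈Y'

  ξ/X⇒conE : ∀ {Y e} → G/X.Inξ Y e → conE F X e
  ξ/X⇒conE (Y' , fY' , _ , e∈Y') = Y' , fY' , e∈Y'

  -- Extend V to a member V' of the flat of X ∪ Y; then V' ─ X lies in the flat of Y over X.
  ξ⇒ξ/X : ∀ {Y V e} → G/X.Feas Y → Feas V → X ⊆ V → (∀ u → u ∈ V → Inξ (X ∪ Y) u) →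
          e ∈ V → e ∉ X → G/X.Inξ Y e
  ξ⇒ξ/X {Y} {V} fY fV X⊆V V⊆ξ e∈V e∉X =
    let V' , fV' , V⊆V' , _ , V'∼XY = extendToFlat (∪-feasible fY) fV V⊆ξ
        X⊆V' : X ⊆ V'
        X⊆V' u∈X = V⊆V' (X⊆V u∈X)
        fV'─X : G/X.Feas (V' ─ X)
        fV'─X = feasible─X fV' X⊆V'
    in V' ─ X , fV'─X ,
       ∼⇒∼/X fV'─X fY (∪[─X]-∼ X⊆V' V'∼XY) ,
       x∈p∧x∉q⇒x∈p─q (V⊆V' e∈V) e∉X

  flat-above : ∀ {W} → Feas W → (∀ u → u ∈ X → Inξ W u) → ∃ λ Z → G/X.Feas Z × (X ∪ Z) ∼ W
  flat-above fW X⊆ξW =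
    let V' , fV' , X⊆V' , _ , V'∼W = extendToFlat fW fX X⊆ξW
    in V' ─ X , feasible─X fV' X⊆V' , ∪[─X]-∼ X⊆V' V'∼W

  FlatLe-intro : ∀ {W Z} → G/X.Feas Z → (X ∪ Z) ∼ W → FlatLe W X
  FlatLe-intro {Z = Z} fZ XZ∼W =
    Z , (λ z z∈Z → ground _ (∪-feasible fZ) z (∈∪ʳ z∈Z) , λ z∈X → disjoint fZ z z∈X z∈Z) ,
    ∪-feasible fZ , XZ∼W

  IsJoin-lift : ∀ {Ya Yb Yc} → G/X.Feas Ya → G/X.Feas Yb → G/X.IsJoin Ya Yb Yc →
                IsJoin (X ∪ Ya) (X ∪ Yb) (X ∪ Yc)
  IsJoin-lift {Ya} {Yb} {Yc} fYa fYb (fYc , Yc⊆ξ , maximal) = ∪-feasible fYc , XYc⊆ξ , XYc-maximal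
    where
    XYc⊆ξ : ∀ e → e ∈ X ∪ Yc → Inξ (X ∪ Ya) e × Inξ (X ∪ Yb) e
    XYc⊆ξ e e∈XYc =
      [ (λ e∈X → ξ-self (∪-feasible fYa) (∈∪ˡ e∈X) , ξ-self (∪-feasible fYb) (∈∪ˡ e∈X)) ,
        (λ e∈Yc → ξ/X⇒ξ fYa (proj₁ (Yc⊆ξ e e∈Yc)) , ξ/X⇒ξ fYb (proj₂ (Yc⊆ξ e e∈Yc))) ]′ (x∈p∪q⁻ X Yc e∈XYc)

    XYc-maximal : ∀ W → Feas W → X ∪ Yc ⊆ W → (∀ e → e ∈ W → Inξ (X ∪ Ya) e × Inξ (X ∪ Yb) e) → W ⊆ X ∪ Yc
    XYc-maximal W fW XYc⊆W W⊆ξ {u} u∈W with u ∈? X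
    ... | yes u∈X = ∈∪ˡ u∈X
    ... | no u∉X = ∈∪ʳ (maximal (W ─ X) (feasible─X fW X⊆W) Yc⊆W─X W─X⊆ξ/X (x∈p∧x∉q⇒x∈p─q u∈W u∉X))
      where
      X⊆W : X ⊆ W
      X⊆W e∈X = XYc⊆W (∈∪ˡ e∈X)
      Yc⊆W─X : Yc ⊆ W ─ X
      Yc⊆W─X {e} e∈Yc = x∈p∧x∉q⇒x∈p─q (XYc⊆W (∈∪ʳ e∈Yc)) (λ e∈X → disjoint fYc e e∈X e∈Yc)
      W─X⊆ξ/X : ∀ e → e ∈ W ─ X → G/X.Inξ Ya e × G/X.Inξ Yb e
      W─X⊆ξ/X e e∈W─X =
        ξ⇒ξ/X fYa fW X⊆W (λ v v∈W → proj₁ (W⊆ξ v v∈W)) (p─q⊆p W X e∈W─X) (x∈p─q⇒x∉q W X e∈W─X) ,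
        ξ⇒ξ/X fYb fW X⊆W (λ v v∈W → proj₂ (W⊆ξ v v∈W)) (p─q⊆p W X e∈W─X) (x∈p─q⇒x∉q W X e∈W─X)

  contraction-IG1 : ∀ Y → G/X.Feas Y → Nonempty Y → ∃ λ y → y ∈ Y × G/X.Feas (Y - y)
  contraction-IG1 Y fY (y₀ , y₀∈Y) =
    let X⊂XY : X ⊂ X ∪ Y
        X⊂XY = ∈∪ˡ , y₀ , ∈∪ʳ y₀∈Y , λ y₀∈X → disjoint fY y₀ y₀∈X y₀∈Y
        y , y∈XY , y∉X , fXY-y = removable-outside fX (∪-feasible fY) ∈∪ˡ (p⊂q⇒∣p∣<∣q∣ X⊂XY)
    in y , x∈p∪q∧x∉p⇒x∈q X Y y∈XY y∉X ,
       feasible/X (λ u u∈X u∈Y-y → disjoint fY u u∈X (p─q⊆p Y ⁅ y ⁆ u∈Y-y))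
                  (subst Feas (sym (y∉p⇒p∪[q-y]≡[p∪q]-y X Y y∉X)) fXY-y)

  contraction-IG2 : ∀ A B → G/X.Feas A → G/X.Feas B → ∣ B ∣ < ∣ A ∣ →
                    ∃ λ x → x ∈ A × x ∉ B × G/X.Feas (B ∪ ⁅ x ⁆)
  contraction-IG2 A B fA fB ∣B∣<∣A∣ =
    let x , x∈XA , x∉XB , fXBx = IG2 (X ∪ A) (X ∪ B) (∪-feasible fA) (∪-feasible fB) ∣XB∣<∣XA∣
        x∉X : x ∉ X
        x∉X x∈X = x∉XB (∈∪ˡ x∈X)
    in x , x∈p∪q∧x∉p⇒x∈q X A x∈XA x∉X , (λ x∈B → x∉XB (∈∪ʳ x∈B)) , feasible/X-∪⁅⁆ fB x∉X fXBx
    where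
    open ≤-Reasoning
    ∣XB∣<∣XA∣ : ∣ X ∪ B ∣ < ∣ X ∪ A ∣
    ∣XB∣<∣XA∣ = begin-strict
      ∣ X ∪ B ∣       ≡⟨ ∣p∪q∣≡∣p∣+∣q∣ X B (disjoint fB) ⟩
      ∣ X ∣ + ∣ B ∣   <⟨ +-monoʳ-< ∣ X ∣ ∣B∣<∣A∣ ⟩
      ∣ X ∣ + ∣ A ∣   ≡⟨ sym (∣p∪q∣≡∣p∣+∣q∣ X A (disjoint fA)) ⟩
      ∣ X ∪ A ∣       ∎

  contraction-IG3 : ∀ A B C e → G/X.Feas A → G/X.Feas B → G/X.Feas C → A ⊆ B → B ⊆ C → e ∉ C →
                    G/X.Feas (A ∪ ⁅ e ⁆) → G/X.Feas (C ∪ ⁅ e ⁆) → G/X.Feas (B ∪ ⁅ e ⁆)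
  contraction-IG3 A B C e fA fB fC A⊆B B⊆C e∉C fAe fCe =
    feasible/X-∪⁅⁆ fB e∉X
      (IG3 (X ∪ A) (X ∪ B) (X ∪ C) e (∪-feasible fA) (∪-feasible fB) (∪-feasible fC)
           (∪-monoʳ-⊆ X A⊆B) (∪-monoʳ-⊆ X B⊆C) e∉XC (∪⁅⁆-feasible fAe) (∪⁅⁆-feasible fCe))
    where
    e∉X : e ∉ X
    e∉X e∈X = disjoint fCe e e∈X (∈∪ʳ (x∈⁅x⁆ e))
    e∉XC : e ∉ X ∪ C
    e∉XC e∈XC = [ e∉X , e∉C ]′ (x∈p∪q⁻ X C e∈XC)

  contraction-isIntervalGreedoid : G/X.IsIntervalGreedoid
  contraction-isIntervalGreedoid = record
    { ground   = λ Y fY y y∈Y → Y , fY , y∈Y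
    ; nonempty = ⊥ , feasible/X (λ _ _ → ∉⊥) (subst Feas (sym (∪-identityʳ X)) fX)
    ; IG1      = contraction-IG1
    ; IG2      = contraction-IG2
    ; IG3      = contraction-IG3
    }

-- Oriented contraction

module OrientedContraction {n : ℕ} {E : Fin n → Set} {F : Subset n → Bool} {L : SignVec n → Set}
                           (og : Greedoid.IsOrientedIntervalGreedoid E F L) {X : Subset n} (fX : T (F X)) where
  open Greedoid E F
  open IsOrientedIntervalGreedoid og
  open IntervalGreedoidTheory isIG
  open Contraction isIG fX
  module T/X = IntervalGreedoidTheory contraction-isIntervalGreedoid

  Eliminant : (SignVec n → Set) → SignVec n → SignVec n → SignVec n → SignVec n → Fin n → Set
  Eliminant L' α β αβ βα x = ∃ λ ε → L' ε × lookup ε x ≡ zer ×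
    (∀ y → ¬ InS α β y → lookup αβ y ≢ one → lookup ε y ≡ lookup αβ y × lookup ε y ≡ lookup βα y)

  L/X : SignVec n → Set
  L/X = conL E F L X

  -- the last component of conL: γ = con_X(α), where supp α = [X ∪ Y]
  record IsContraction (γ α : SignVec n) (Y : Subset n) : Set where
    field
      feasible : G/X.Feas Y
      supportα : CovOf (X ∪ Y) α
      supportγ : G/X.CovOf Y γ
      agrees   : ∀ e → G/X.InΓ Y e → lookup γ e ≡ lookup α e
  open IsContraction

  L/X-intro : ∀ {γ α Y} → L α → IsContraction γ α Y → L/X γ
  L/X-intro {α = α} {Y} Lα r =
    α , Lα , (X ∪ Y , supportα r , FlatLe-intro (feasible r) ∼-refl) ,
    Y , feasible r , supportα r , supportγ r , agrees r

  L/X-elim : ∀ γ → L/X γ → ∃ λ α → L α × ∃ λ Y → IsContraction γ α Y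
  L/X-elim _ (α , Lα , _ , Y , fY , cα , cγ , agr) =
    α , Lα , Y , record { feasible = fY ; supportα = cα ; supportγ = cγ ; agrees = agr }

  module _ {γ α Y} (r : IsContraction γ α Y) where

    reroute : ∀ {Y'} → G/X.CovOf Y' γ → IsContraction γ α Y'
    reroute {Y'} cγ' = record
      { feasible = fY'
      ; supportα = CovOf-resp-∼ α (∼/X⇒∼ (feasible r) fY' Y∼Y') (∪-feasible fY') (supportα r)
      ; supportγ = cγ'
      ; agrees   = λ e g → agrees r e (proj₂ (Y∼Y' e) g)
      }
      where
      fY' : G/X.Feas Y'
      fY' = T/X.cov-feasible γ cγ'
      Y∼Y' : G/X._∼_ Y Y'
      Y∼Y' = T/X.CovOf⇒∼ γ (supportγ r) cγ'

    negate : IsContraction (map negˢ γ) (map negˢ α) Y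
    negate = record
      { feasible = feasible r
      ; supportα = CovOf-neg α (supportα r)
      ; supportγ = T/X.CovOf-neg γ (supportγ r)
      ; agrees   = λ e g → trans (lookup-map e negˢ γ) (trans (cong negˢ (agrees r e g)) (sym (lookup-map e negˢ α)))
      }

    agree-signed : ∀ {e} → Signed (lookup α e) → lookup γ e ≡ lookup α e
    agree-signed s = agrees r _ (Γ⇒Γ/X (feasible r) (signed⇒InΓ α (supportα r) s))

    agree-≢one : ∀ {e} → lookup γ e ≢ one → lookup γ e ≡ lookup α e
    agree-≢one {e} γ≢one with T/X.InΓ? Y e | T/X.Inξ? Y e
    ... | yes g | _ = agrees r e g
    ... | no _ | yes x = trans (T/X.cov-zer γ (supportγ r) x) (sym (cov-zer α (supportα r) (ξ/X⇒ξ (feasible r) x)))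
    ... | no ¬g | no ¬x = ⊥-elim (γ≢one (T/X.cov-one γ (supportγ r) ¬g ¬x))

    zer-on : ∀ {V e} → Feas V → X ⊆ V → (∀ u → u ∈ V → lookup α u ≡ zer) → e ∈ V → e ∉ X → lookup γ e ≡ zer
    zer-on fV X⊆V α≡zer e∈V e∉X =
      T/X.cov-zer γ (supportγ r)
        (ξ⇒ξ/X (feasible r) fV X⊆V (λ u u∈V → zer⇒Inξ α (supportα r) (α≡zer u u∈V)) e∈V e∉X)

    -- Off Γ/X(Y), either e ∈ ξ(X ∪ Y), where both vanish (through the feasible C ∪ ⁅ e ⁆), or both are 1.
    agree-on-Γ : ∀ {C e} → Feas C → X ⊆ C → (∀ u → u ∈ C → Inξ (X ∪ Y) u) → InΓ C e →
                 lookup γ e ≡ lookup α e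
    agree-on-Γ {C} {e} fC X⊆C C⊆ξ (_ , e∉C , fCe) with T/X.InΓ? Y e | Inξ? (X ∪ Y) e
    ... | yes g | _ = agrees r e g
    ... | no _ | yes x = trans (zer-on fCe (λ u∈X → ∈∪ˡ (X⊆C u∈X)) α≡zer (∈∪ʳ (x∈⁅x⁆ e)) (λ e∈X → e∉C (X⊆C e∈X)))
                               (sym (cov-zer α (supportα r) x))
      where
      α≡zer : ∀ u → u ∈ C ∪ ⁅ e ⁆ → lookup α u ≡ zer
      α≡zer u u∈Ce = [ (λ u∈C → cov-zer α (supportα r) (C⊆ξ u u∈C)) , (λ { refl → cov-zer α (supportα r) x }) ]′
                       (x∈p∪⁅y⁆⁻ C e u∈Ce)
    ... | no ¬g | no ¬x = trans (T/X.cov-one γ (supportγ r) ¬g (λ x → ¬x (ξ/X⇒ξ (feasible r) x)))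
                                (sym (cov-one α (supportα r) (λ g → ¬g (Γ⇒Γ/X (feasible r) g)) ¬x))

  separated⇒ : ∀ {γ₁ γ₂ α β Y₁ Y₂ x} → IsContraction γ₁ α Y₁ → IsContraction γ₂ β Y₂ →
               InS γ₁ γ₂ x → InS α β x
  separated⇒ r₁ r₂ s = Separated-cong (agree-≢one r₁ (signed≢one (Separated-signedˡ s)))
                                      (agree-≢one r₂ (signed≢one (Separated-signedʳ s))) s

  ⇒separated : ∀ {γ₁ γ₂ α β Y₁ Y₂ x} → IsContraction γ₁ α Y₁ → IsContraction γ₂ β Y₂ →
               InS α β x → InS γ₁ γ₂ x
  ⇒separated r₁ r₂ s = Separated-cong (sym (agree-signed r₁ (Separated-signedˡ s)))
                                      (sym (agree-signed r₂ (Separated-signedʳ s))) s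

  -- The product γ₁ ∘ γ₂ over X is the contraction of α ∘ β, computed with the lifted join X ∪ Yc.
  module ProductLift {γ₁ γ₂ α β Y₁ Y₂ Yc} (Lα : L α) (Lβ : L β)
                     (r₁ : IsContraction γ₁ α Y₁) (r₂ : IsContraction γ₂ β Y₂) (join : G/X.IsJoin Y₁ Y₂ Yc) where

    C : Subset n
    C = X ∪ Yc

    δ : SignVec n
    δ = product C α β

    fC : Feas C
    fC = ∪-feasible (proj₁ join)

    lifted-join : IsJoin (X ∪ Y₁) (X ∪ Y₂) C
    lifted-join = IsJoin-lift (feasible r₁) (feasible r₂) join

    isProd : IsProd α β δ
    isProd = X ∪ Y₁ , X ∪ Y₂ , C , supportα r₁ , supportα r₂ , lifted-join , product-ProductOn C α β

    Lδ : L δ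
    Lδ = OG3 α β δ Lα Lβ isProd

    supportδ : CovOf C δ
    supportδ = product-support α β (supportα r₁) (supportα r₂) lifted-join (proj₂ (covectors δ Lδ))

    δ-zer-on-C : ∀ u → u ∈ C → lookup δ u ≡ zer
    δ-zer-on-C = product-zer-on-join α β (supportα r₁) (supportα r₂) lifted-join

    δ-zer⇒αβ-zer : ∀ {u} → lookup δ u ≡ zer → lookup α u ≡ zer × lookup β u ≡ zer
    δ-zer⇒αβ-zer {u} = ProductAt-zer (product-ProductOn C α β u)

    contracts : ∀ γ → T/X.ProductOn Yc γ₁ γ₂ γ → IsContraction γ δ Yc
    contracts γ pw = record
      { feasible = fYc
      ; supportα = supportδ
      ; supportγ = fYc , λ e → signed-on-Γ e , zer-on-ξ e , λ ¬g ¬x → proj₂ (pw e) [ ¬g , ¬x ]′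
      ; agrees   = agrees-on-Γ
      }
      where
      fYc : G/X.Feas Yc
      fYc = proj₁ join
      C⊆ξ : ∀ u → u ∈ C → Inξ (X ∪ Y₁) u × Inξ (X ∪ Y₂) u
      C⊆ξ = proj₁ (proj₂ lifted-join)
      open ≡-Reasoning

      agrees-on-Γ : ∀ e → G/X.InΓ Yc e → lookup γ e ≡ lookup δ e
      agrees-on-Γ e g = begin
        lookup γ e                  ≡⟨ T/X.ProductAt-inside (pw e) (inj₁ g) ⟩
        lookup γ₁ e ·ˢ lookup γ₂ e  ≡⟨ cong₂ _·ˢ_ (agree-on-Γ r₁ fC ∈∪ˡ (λ u u∈C → proj₁ (C⊆ξ u u∈C)) (Γ/X⇒Γ g))
                                                  (agree-on-Γ r₂ fC ∈∪ˡ (λ u u∈C → proj₂ (C⊆ξ u u∈C)) (Γ/X⇒Γ g)) ⟩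
        lookup α e ·ˢ lookup β e    ≡⟨ sym (ProductAt-inside (product-ProductOn C α β e) (inj₁ (Γ/X⇒Γ g))) ⟩
        lookup δ e                  ∎

      signed-on-Γ : ∀ e → G/X.InΓ Yc e → Signed (lookup γ e)
      signed-on-Γ e g = subst Signed (sym (agrees-on-Γ e g)) (cov-signed δ supportδ (Γ/X⇒Γ g))

      zer-on-ξ : ∀ e → G/X.Inξ Yc e → lookup γ e ≡ zer
      zer-on-ξ e x@(Y' , fY' , Y'∼Yc , e∈Y') =
        T/X.ProductAt-inside-zer (pw e) (inj₂ x) (zer-on r₁ fV ∈∪ˡ (λ u u∈V → proj₁ (αβ≡zer u u∈V)) e∈V e∉X)
                                                 (zer-on r₂ fV ∈∪ˡ (λ u u∈V → proj₂ (αβ≡zer u u∈V)) e∈V e∉X)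
        where
        fV : Feas (X ∪ Y')
        fV = ∪-feasible fY'
        e∈V : e ∈ X ∪ Y'
        e∈V = ∈∪ʳ e∈Y'
        e∉X : e ∉ X
        e∉X = conE⇒∉X (ξ/X⇒conE x)
        αβ≡zer : ∀ u → u ∈ X ∪ Y' → lookup α u ≡ zer × lookup β u ≡ zer
        αβ≡zer u u∈V = δ-zer⇒αβ-zer (cov-zer δ supportδ (ξ-resp-∼ (∼/X⇒∼ fY' fYc Y'∼Yc) (ξ-self fV u∈V)))

  product-in-L/X : ∀ {γ₁ γ₂ α β Y₁ Y₂ Yc} γ → L α → L β → IsContraction γ₁ α Y₁ → IsContraction γ₂ β Y₂ →
                   G/X.IsJoin Y₁ Y₂ Yc → T/X.ProductOn Yc γ₁ γ₂ γ → L/X γ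
  product-in-L/X γ Lα Lβ r₁ r₂ join pw = L/X-intro Lδ (contracts γ pw)
    where open ProductLift Lα Lβ r₁ r₂ join

  -- An eliminant ε of α ∘ β and β ∘ α at x vanishes on X, so its contraction ε' eliminates x over X.
  module Elimination {γ₁ γ₂ α β Y₁ Y₂ Y₁' Y₂' Y₁₂ Y₂₁ x} (γ₁₂ γ₂₁ : SignVec n) (Lα : L α) (Lβ : L β)
           (r₁ : IsContraction γ₁ α Y₁) (r₂ : IsContraction γ₂ β Y₂)
           (join₁₂ : G/X.IsJoin Y₁ Y₂ Y₁₂) (pw₁₂ : T/X.ProductOn Y₁₂ γ₁ γ₂ γ₁₂)
           (r₂' : IsContraction γ₂ β Y₂') (r₁' : IsContraction γ₁ α Y₁')
           (join₂₁ : G/X.IsJoin Y₂' Y₁' Y₂₁) (pw₂₁ : T/X.ProductOn Y₂₁ γ₂ γ₁ γ₂₁)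
           (x∈S : InS γ₁ γ₂ x) (γ₁₂x≢one : lookup γ₁₂ x ≢ one) where

    module P₁₂ = ProductLift Lα Lβ r₁ r₂ join₁₂
    module P₂₁ = ProductLift Lβ Lα r₂' r₁' join₂₁
    open P₁₂ using (C; δ-zer-on-C; δ-zer⇒αβ-zer)

    δ₁₂ δ₂₁ : SignVec n
    δ₁₂ = P₁₂.δ
    δ₂₁ = P₂₁.δ

    ρ₁₂ : IsContraction γ₁₂ δ₁₂ Y₁₂
    ρ₁₂ = P₁₂.contracts γ₁₂ pw₁₂

    ρ₂₁ : IsContraction γ₂₁ δ₂₁ Y₂₁
    ρ₂₁ = P₂₁.contracts γ₂₁ pw₂₁

    x∈S[α,β] : InS α β x
    x∈S[α,β] = separated⇒ r₁ r₂ x∈S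

    δ₁₂x≢one : lookup δ₁₂ x ≢ one
    δ₁₂x≢one δ₁₂x≡one = γ₁₂x≢one (trans (agree-≢one ρ₁₂ γ₁₂x≢one) δ₁₂x≡one)

    eliminant-of-lifts : Eliminant L α β δ₁₂ δ₂₁ x
    eliminant-of-lifts = OG4 α β δ₁₂ δ₂₁ x Lα Lβ P₁₂.isProd P₂₁.isProd x∈S[α,β] δ₁₂x≢one

    ε : SignVec n
    ε = proj₁ eliminant-of-lifts

    Lε : L ε
    Lε = proj₁ (proj₂ eliminant-of-lifts)

    εx≡zer : lookup ε x ≡ zer
    εx≡zer = proj₁ (proj₂ (proj₂ eliminant-of-lifts))

    ε-agrees : ∀ y → ¬ InS α β y → lookup δ₁₂ y ≢ one → lookup ε y ≡ lookup δ₁₂ y × lookup ε y ≡ lookup δ₂₁ y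
    ε-agrees = proj₂ (proj₂ (proj₂ eliminant-of-lifts))

    -- where δ₁₂ vanishes so does α, hence such a point is not separated by α and β
    ε-agrees-where-δ₁₂-zer : ∀ {u} → lookup δ₁₂ u ≡ zer → lookup ε u ≡ zer × lookup δ₂₁ u ≡ zer
    ε-agrees-where-δ₁₂-zer {u} δu≡zer =
      let ε≡δ₁₂ , ε≡δ₂₁ = ε-agrees u (zer-not-Separated (proj₁ (δ-zer⇒αβ-zer δu≡zer)))
                                     (λ δu≡one → zer≢one (trans (sym δu≡zer) δu≡one))
      in trans ε≡δ₁₂ δu≡zer , trans (sym ε≡δ₂₁) (trans ε≡δ₁₂ δu≡zer)

    supportW : CovOf (proj₁ (covectors ε Lε)) ε
    supportW = proj₂ (covectors ε Lε)

    flat-of-ε : ∃ λ Z → G/X.Feas Z × (X ∪ Z) ∼ proj₁ (covectors ε Lε)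
    flat-of-ε = flat-above (cov-feasible ε supportW)
                  λ u u∈X → zer⇒Inξ ε supportW (proj₁ (ε-agrees-where-δ₁₂-zer (δ-zer-on-C u (∈∪ˡ u∈X))))

    Z : Subset n
    Z = proj₁ flat-of-ε

    fZ : G/X.Feas Z
    fZ = proj₁ (proj₂ flat-of-ε)

    supportε : CovOf (X ∪ Z) ε
    supportε = CovOf-resp-∼ ε (∼-sym (proj₂ (proj₂ flat-of-ε))) (∪-feasible fZ) supportW

    contraction-of-ε : Σ (SignVec n) λ v → G/X.CovOf Z v × (∀ e → G/X.InΓ Z e → lookup v e ≡ lookup ε e)
    contraction-of-ε = T/X.covectorWith fZ (lookup ε) (λ e g → cov-signed ε supportε (Γ/X⇒Γ g))

    ε' : SignVec n
    ε' = proj₁ contraction-of-ε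

    ρε : IsContraction ε' ε Z
    ρε = record { feasible = fZ ; supportα = supportε
                ; supportγ = proj₁ (proj₂ contraction-of-ε) ; agrees = proj₂ (proj₂ contraction-of-ε) }

    x∈ΓC : InΓ C x
    x∈ΓC = signed⇒InΓ δ₁₂ P₁₂.supportδ
             (subst Signed (sym (ProductAt-≢one (product-ProductOn C α β x) δ₁₂x≢one)) (·ˢ-separated x∈S[α,β]))

    ε'x≡zer : lookup ε' x ≡ zer
    ε'x≡zer = zer-on ρε (proj₂ (proj₂ x∈ΓC)) (λ u∈X → ∈∪ˡ (∈∪ˡ u∈X)) εu≡zer (∈∪ʳ (x∈⁅x⁆ x))
                     (λ x∈X → proj₁ (proj₂ x∈ΓC) (∈∪ˡ x∈X))
      where
      εu≡zer : ∀ u → u ∈ C ∪ ⁅ x ⁆ → lookup ε u ≡ zer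
      εu≡zer u u∈Cx = [ (λ u∈C → proj₁ (ε-agrees-where-δ₁₂-zer (δ-zer-on-C u u∈C))) , (λ { refl → εx≡zer }) ]′
                        (x∈p∪⁅y⁆⁻ C x u∈Cx)

    zer-on-flat : ∀ {y} → G/X.Inξ Y₁₂ y → lookup ε' y ≡ zer × lookup γ₂₁ y ≡ zer
    zer-on-flat {y} y∈ξ@(Y' , fY' , Y'∼Y₁₂ , y∈Y') =
      zer-on ρε fV ∈∪ˡ (λ u u∈V → proj₁ (ε-agrees-where-δ₁₂-zer (δ₁₂≡zer u u∈V))) y∈V y∉X ,
      zer-on ρ₂₁ fV ∈∪ˡ (λ u u∈V → proj₂ (ε-agrees-where-δ₁₂-zer (δ₁₂≡zer u u∈V))) y∈V y∉X
      where
      fV : Feas (X ∪ Y')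
      fV = ∪-feasible fY'
      y∈V : y ∈ X ∪ Y'
      y∈V = ∈∪ʳ y∈Y'
      y∉X : y ∉ X
      y∉X = conE⇒∉X (ξ/X⇒conE y∈ξ)
      δ₁₂≡zer : ∀ u → u ∈ X ∪ Y' → lookup δ₁₂ u ≡ zer
      δ₁₂≡zer u u∈V = cov-zer δ₁₂ P₁₂.supportδ (ξ-resp-∼ (∼/X⇒∼ fY' (feasible ρ₁₂) Y'∼Y₁₂) (ξ-self fV u∈V))

    ε'-agrees : ∀ y → ¬ InS γ₁ γ₂ y → lookup γ₁₂ y ≢ one →
                lookup ε' y ≡ lookup γ₁₂ y × lookup ε' y ≡ lookup γ₂₁ y
    ε'-agrees y y∉S γ₁₂y≢one = [ signed-case , [ zer-case , one-case ]′ ]′ (sign-cases (lookup ε y))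
      where
      γ₁₂≡δ₁₂ : lookup γ₁₂ y ≡ lookup δ₁₂ y
      γ₁₂≡δ₁₂ = agree-≢one ρ₁₂ γ₁₂y≢one

      δ₁₂y≢one : lookup δ₁₂ y ≢ one
      δ₁₂y≢one δ₁₂y≡one = γ₁₂y≢one (trans γ₁₂≡δ₁₂ δ₁₂y≡one)

      ε≡δ : lookup ε y ≡ lookup δ₁₂ y × lookup ε y ≡ lookup δ₂₁ y
      ε≡δ = ε-agrees y (λ y∈S[α,β] → y∉S (⇒separated r₁ r₂ y∈S[α,β])) δ₁₂y≢one

      Goal : Set
      Goal = lookup ε' y ≡ lookup γ₁₂ y × lookup ε' y ≡ lookup γ₂₁ y

      signed-case : Signed (lookup ε y) → Goal
      signed-case εy-signed =
        trans ε'≡ε (trans (proj₁ ε≡δ) (sym γ₁₂≡δ₁₂)) ,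
        trans ε'≡ε (trans (proj₂ ε≡δ) (sym (agree-signed ρ₂₁ (subst Signed (proj₂ ε≡δ) εy-signed))))
        where
        ε'≡ε : lookup ε' y ≡ lookup ε y
        ε'≡ε = agree-signed ρε εy-signed

      zer-case : lookup ε y ≡ zer → Goal
      zer-case εy≡zer =
        let γ₁₂y≡zer = trans γ₁₂≡δ₁₂ (trans (sym (proj₁ ε≡δ)) εy≡zer)
            ε'y≡zer , γ₂₁y≡zer = zer-on-flat (T/X.zer⇒Inξ γ₁₂ (supportγ ρ₁₂) γ₁₂y≡zer)
        in trans ε'y≡zer (sym γ₁₂y≡zer) , trans ε'y≡zer (sym γ₂₁y≡zer)

      one-case : lookup ε y ≡ one → Goal
      one-case εy≡one = ⊥-elim (δ₁₂y≢one (trans (sym (proj₁ ε≡δ)) εy≡one))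

    eliminant : Eliminant L/X γ₁ γ₂ γ₁₂ γ₂₁ x
    eliminant = ε' , L/X-intro Lε ρε , ε'x≡zer , ε'-agrees

  contraction-covectors : ∀ γ → L/X γ → G/X.IsCovector γ
  contraction-covectors γ Lγ = let _ , _ , Y , r = L/X-elim γ Lγ in Y , supportγ r

  contraction-OG1 : ∀ Y → G/X.Feas Y → ∃ λ γ → L/X γ × G/X.CovOf Y γ
  contraction-OG1 Y fY =
    let α , Lα , cα = OG1 (X ∪ Y) (∪-feasible fY)
        γ , cγ , agr = T/X.covectorWith fY (lookup α) (λ e g → cov-signed α cα (Γ/X⇒Γ g))
        r : IsContraction γ α Y
        r = record { feasible = fY ; supportα = cα ; supportγ = cγ ; agrees = agr }
    in γ , L/X-intro Lα r , cγ

  contraction-OG2 : ∀ γ → L/X γ → L/X (map negˢ γ)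
  contraction-OG2 γ Lγ = let α , Lα , _ , r = L/X-elim γ Lγ in L/X-intro (OG2 α Lα) (negate r)

  contraction-OG3 : ∀ γ₁ γ₂ γ → L/X γ₁ → L/X γ₂ → G/X.IsProd γ₁ γ₂ γ → L/X γ
  contraction-OG3 γ₁ γ₂ γ Lγ₁ Lγ₂ (_ , _ , _ , c₁ , c₂ , join , pw) =
    let _ , Lα , _ , r₁ = L/X-elim γ₁ Lγ₁
        _ , Lβ , _ , r₂ = L/X-elim γ₂ Lγ₂
    in product-in-L/X γ Lα Lβ (reroute r₁ c₁) (reroute r₂ c₂) join pw

  contraction-OG4 : ∀ γ₁ γ₂ γ₁₂ γ₂₁ x → L/X γ₁ → L/X γ₂ → G/X.IsProd γ₁ γ₂ γ₁₂ → G/X.IsProd γ₂ γ₁ γ₂₁ →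
                    InS γ₁ γ₂ x → lookup γ₁₂ x ≢ one → Eliminant L/X γ₁ γ₂ γ₁₂ γ₂₁ x
  contraction-OG4 γ₁ γ₂ γ₁₂ γ₂₁ x Lγ₁ Lγ₂ (_ , _ , _ , c₁ , c₂ , join₁₂ , pw₁₂)
                                          (_ , _ , _ , c₂' , c₁' , join₂₁ , pw₂₁) =
    let _ , Lα , _ , r₁ = L/X-elim γ₁ Lγ₁
        _ , Lβ , _ , r₂ = L/X-elim γ₂ Lγ₂
    in Elimination.eliminant γ₁₂ γ₂₁ Lα Lβ (reroute r₁ c₁) (reroute r₂ c₂) join₁₂ pw₁₂
                                   (reroute r₂ c₂') (reroute r₁ c₁') join₂₁ pw₂₁

mainTheorem9 : ∀ {n : ℕ} (E : Fin n → Set) (F : Subset n → Bool)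
                 (L : SignVec n → Set) (X : Subset n) →
                 Greedoid.IsOrientedIntervalGreedoid E F L →
                 T (F X) →
                 Greedoid.IsOrientedIntervalGreedoid (conE F X) (conF F X) (conL E F L X)
mainTheorem9 E F L X og fX = record
  { isIG      = contraction-isIntervalGreedoid
  ; covectors = contraction-covectors
  ; OG1       = contraction-OG1
  ; OG2       = contraction-OG2
  ; OG3       = contraction-OG3
  ; OG4       = contraction-OG4
  }
  where
  open Greedoid.IsOrientedIntervalGreedoid og using (isIG)
  open Contraction isIG fX using (contraction-isIntervalGreedoid)
  open OrientedContraction og fX
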